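{- Let $0<\lambda\le1$ be a rational number and let $\{x_n\}_{n=1}^\infty$ be the infinite greedy Egyptian underapproximation of $\lambda$. Then there exists a positive integer $N$ such that: (1) the terms $x_1,x_2,\dots,x_{N-1},x_N-1$ form the greedy Egyptian approximation of $\lambda$, i.e. \[ \lambda=\frac1{x_1}+\cdots+\frac1{x_{N-1}}+\frac1{x_N-1} \] is the Egyptian fraction produced by the greedy approximation algorithm; and (2) the terms $x_N,x_{N+1},x_{N+2},\dots$ form the infinite greedy Egyptian underapproximation of the unit fraction $\frac1{x_N-1}$.
   Context: The infinite greedy Egyptian underapproximation of $0<\lambda\le1$ is the sequence defined recursively by $x_i=\big\lfloor(\lambda-\sum_{j=1}^{i-1}1/x_j)^{ -1}\big\rfloor+1$ for all $i\ge1$ (empty sum $=0$). The greedy Egyptian approximation of a rational $0<\lambda\le1$ is the finite sequence $y_1,y_2,\dots$ constructed recursively by letting $y_m$ be the smallest integer $k\ge2$ not among $y_1,\dots,y_{m-1}$ such that $\sum_{i=1}^{m-1}1/y_i+1/k\le\lambda$, stopping as soon as $\sum_i 1/y_i=\lambda$ (this happens after finitely many steps). -}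

module Defs where

open import Data.Nat using (ℕ; zero; suc)
open import Data.Integer using (+_; ∣_∣)
open import Data.Rational using (ℚ; 0ℚ; _+_; _-_; _/_; 1/_; floor; _≤_; _<_; _≟_; ≢-nonZero)
open import Data.List using (List; []; _∷_; _++_; [_]; foldr)
open import Data.List.Membership.Propositional using (_∉_)
open import Data.Product using (_×_)
open import Relation.Nullary using (yes; no)
open import Relation.Binary.PropositionalEquality using (_≡_)

-- 1/n as a rational (junk value 0 for n = 0; never used at 0 below)
recip : ℕ → ℚ
recip zero    = 0ℚ
recip (suc k) = + 1 / suc k

sumRecip : List ℕ → ℚ
sumRecip = foldr (λ y s → recip y + s) 0ℚ

-- ⌊ r⁻¹ ⌋ + 1 for a nonzero rational r (junk value 1 at r = 0,
-- which never occurs for the remainders of the greedy underapproximation)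
nextTerm : ℚ → ℕ
nextTerm r with r ≟ 0ℚ
... | yes _   = 1
... | no r≢0  = suc ∣ floor ((1/ r) {{≢-nonZero r≢0}}) ∣

-- remainder λ - Σ_{j<i} 1/x_j  (0-indexed: x 0 is the paper's x₁)
remainder : ℚ → ℕ → ℚ
remainder λ′ zero    = λ′
remainder λ′ (suc i) = remainder λ′ i - recip (nextTerm (remainder λ′ i))

-- the infinite greedy Egyptian underapproximation, 0-indexed:
-- infGreedy λ i = x_{i+1} = ⌊ (λ - Σ_{j≤i} 1/x_j)⁻¹ ⌋ + 1
infGreedy : ℚ → ℕ → ℕ
infGreedy λ′ i = nextTerm (remainder λ′ i)

GreedyChoice : ℚ → List ℕ → ℕ → Set
GreedyChoice λ′ pre y =
  (2 Data.Nat.≤ y) × (y ∉ pre) × (sumRecip pre + recip y ≤ λ′) ×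
  (∀ k → 2 Data.Nat.≤ k → k Data.Nat.< y → k ∉ pre → λ′ < sumRecip pre + recip k)

-- GreedyFrom λ pre ys : continuing the greedy algorithm after `pre`
-- produces exactly the terms ys and then stops (sum reaches λ)
GreedyFrom : ℚ → List ℕ → List ℕ → Set
GreedyFrom λ′ pre []       = sumRecip pre ≡ λ′
GreedyFrom λ′ pre (y ∷ ys) = GreedyChoice λ′ pre y × GreedyFrom λ′ (pre ++ [ y ]) ys

IsGreedyEgyptian : ℚ → List ℕ → Set
IsGreedyEgyptian λ′ ys = GreedyFrom λ′ [] ys

-- A remainder r = n/d in lowest terms with 0 < r < 1 gets the greedy term
-- x = ⌊d/n⌋ + 1, and r - 1/x = (n x - d)/(d x) has numerator at most
-- n x - d = n - (d mod n).  For n > 1 coprimality forces d mod n ≠ 0, so the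
-- numerators of the remainders strictly decrease until the first remainder
-- r_M = 1/D that is a unit fraction.  The same inequality d mod n ≠ 0 makes
-- every k < x with 2 ≤ k overshoot, so x_0, …, x_{M-1} are the greedy choices;
-- since r_{i+1} < 1/x_i the terms increase and stay below D, and D finishes the
-- expansion.  From M on, the remainders are those of 1/D = 1/(x_M - 1).

module Submission where

open import Defs

open import Data.Empty using (⊥-elim)
open import Data.Integer as ℤ using (+_; +[1+_]; -[1+_]; +<+)
import Data.Integer.Properties as ℤ
open import Data.List using ([]; _∷_; map; upTo; _++_; [_])
import Data.List.Properties as List
open import Data.List.Membership.Propositional using (_∉_)
open import Data.List.Membership.Propositional.Properties using (∈-map⁻; ∈-upTo⁻)
open import Data.List.Relation.Unary.Any using (here; there)
open import Data.Nat as ℕ using (ℕ; zero; suc; NonZero; z≤n; s≤s; _∸_)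
import Data.Nat.Properties as ℕ
open import Data.Nat.Coprimality using (Coprime; 1-coprimeTo; recompute)
open import Data.Nat.Divisibility using (∣-refl; m%n≡0⇒n∣m)
open import Data.Nat.DivMod using (_/_; _%_; m≡m%n+[m/n]*n; m%n<n; m*n/n≡m; /-monoˡ-≤; m≥n⇒m/n>0; n/1≡n)
open import Data.Product using (∃-syntax; _×_; _,_; proj₁; proj₂)
open import Data.Rational as ℚ using (ℚ; mkℚ; ↥_; ↧ₙ_; 0ℚ; 1ℚ; _+_; _-_; _<_; _≤_; *<*)
import Data.Rational.Properties as ℚ
open import Data.Rational.Solver using (module +-*-Solver)
open import Data.Sum using (inj₁; inj₂)
open import Relation.Binary.Definitions using (tri<; tri≈; tri>)
open import Relation.Binary.PropositionalEquality hiding ([_])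
open import Relation.Nullary using (¬_; Dec; yes; no)
open import Relation.Nullary.Decidable using (True; toWitness)

-- Euclidean division

module _ (d n : ℕ) .{{_ : NonZero n}} where

  private
    d≡d/n*n+d%n : d ≡ d / n ℕ.* n ℕ.+ d % n
    d≡d/n*n+d%n = trans (m≡m%n+[m/n]*n d n) (ℕ.+-comm (d % n) _)

    n*[1+d/n]≡d/n*n+n : n ℕ.* suc (d / n) ≡ d / n ℕ.* n ℕ.+ n
    n*[1+d/n]≡d/n*n+n = trans (ℕ.*-comm n (suc (d / n))) (ℕ.+-comm n _)

  d<n*[1+d/n] : d ℕ.< n ℕ.* suc (d / n)
  d<n*[1+d/n] = begin-strict
    d                      ≡⟨ d≡d/n*n+d%n ⟩
    d / n ℕ.* n ℕ.+ d % n  <⟨ ℕ.+-monoʳ-< (d / n ℕ.* n) (m%n<n d n) ⟩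
    d / n ℕ.* n ℕ.+ n      ≡⟨ sym n*[1+d/n]≡d/n*n+n ⟩
    n ℕ.* suc (d / n)      ∎
    where open ℕ.≤-Reasoning

  n*[1+d/n]∸d≡n∸d%n : n ℕ.* suc (d / n) ∸ d ≡ n ∸ d % n
  n*[1+d/n]∸d≡n∸d%n = begin
    n ℕ.* suc (d / n) ∸ d                        ≡⟨ cong₂ _∸_ n*[1+d/n]≡d/n*n+n d≡d/n*n+d%n ⟩
    (d / n ℕ.* n ℕ.+ n) ∸ (d / n ℕ.* n ℕ.+ d % n) ≡⟨ ℕ.[m+n]∸[m+o]≡n∸o (d / n ℕ.* n) n (d % n) ⟩
    n ∸ d % n                                    ∎
    where open ≡-Reasoning

  k*n≤d⇒k≤d/n : ∀ k → k ℕ.* n ℕ.≤ d → k ℕ.≤ d / n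
  k*n≤d⇒k≤d/n k k*n≤d = subst (ℕ._≤ d / n) (m*n/n≡m k n) (/-monoˡ-≤ n k*n≤d)

  k≤d/n⇒k*n<d : d % n ≢ 0 → ∀ k → k ℕ.≤ d / n → k ℕ.* n ℕ.< d
  k≤d/n⇒k*n<d d%n≢0 k k≤d/n = begin-strict
    k ℕ.* n                ≤⟨ ℕ.*-monoˡ-≤ n k≤d/n ⟩
    d / n ℕ.* n            <⟨ ℕ.m<n+m (d / n ℕ.* n) (ℕ.n≢0⇒n>0 d%n≢0) ⟩
    d % n ℕ.+ d / n ℕ.* n  ≡⟨ sym (m≡m%n+[m/n]*n d n) ⟩
    d                      ∎
    where open ℕ.≤-Reasoning

-- Positive rationals

↥ₙ_ : ℚ → ℕ
↥ₙ p = ℤ.∣ ↥ p ∣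

0<p⇒↥p≡+↥ₙp : ∀ {p} → 0ℚ < p → ↥ p ≡ + ↥ₙ p
0<p⇒↥p≡+↥ₙp {mkℚ (+ _) _ _}    _              = refl
0<p⇒↥p≡+↥ₙp {mkℚ -[1+ _ ] _ _} (*<* ())

*<*ₙ : ∀ {p r P R} → ↥ p ≡ + P → ↥ r ≡ + R → P ℕ.* ↧ₙ r ℕ.< R ℕ.* ↧ₙ p → p < r
*<*ₙ {mkℚ _ _ _} {mkℚ _ _ _} {P} {R} refl refl h = *<* (subst₂ ℤ._<_ (ℤ.pos-* P _) (ℤ.pos-* R _) (+<+ h))

drop-*<*ₙ : ∀ {p r P R} → ↥ p ≡ + P → ↥ r ≡ + R → p < r → P ℕ.* ↧ₙ r ℕ.< R ℕ.* ↧ₙ p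
drop-*<*ₙ {mkℚ _ _ _} {mkℚ _ _ _} {P} {R} refl refl p<r =
  ℤ.drop‿+<+ (subst₂ ℤ._<_ (sym (ℤ.pos-* P _)) (sym (ℤ.pos-* R _)) (ℚ.drop-*<* p<r))

<⇒0<- : ∀ {p q} → p < q → 0ℚ < q - p
<⇒0<- {p} {q} p<q = subst (_< q - p) (ℚ.+-inverseʳ p) (ℚ.+-monoˡ-< (ℚ.- p) p<q)

-- g is the gcd by which _+_ normalises; the library keeps its name private.
+-reduced : ∀ p q → ∃[ g ] (↥ (p + q) ℤ.* + g ≡ ↥ p ℤ.* ℚ.↧ q ℤ.+ ↥ q ℤ.* ℚ.↧ p)
                          × (ℚ.↧ (p + q) ℤ.* + g ≡ ℚ.↧ p ℤ.* ℚ.↧ q)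
+-reduced p q = _ , ℚ.↥-+ p q , ℚ.↧-+ p q

data PositiveView : ℚ → Set where
  fraction : ∀ a b .(c : Coprime (suc a) (suc b)) → PositiveView (mkℚ +[1+ a ] b c)

positiveView : ∀ {r} → 0ℚ < r → PositiveView r
positiveView {mkℚ +[1+ a ] b c} _           = fraction a b c
positiveView {mkℚ (+ 0) _ _}   (*<* (+<+ ()))
positiveView {mkℚ -[1+ _ ] _ _} (*<* ())

recip-suc : ∀ k → recip (suc k) ≡ mkℚ (+ 1) k (1-coprimeTo (suc k))
recip-suc k = ℚ.normalize-coprime (1-coprimeTo (suc k))

recip-antimono-< : ∀ {k D} → 1 ℕ.≤ k → k ℕ.< D → recip D < recip k
recip-antimono-< {suc k} {suc D} _ k<D = subst₂ _<_ (sym (recip-suc D)) (sym (recip-suc k))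
  (*<*ₙ refl refl (subst₂ ℕ._<_ (sym (ℕ.*-identityˡ _)) (sym (ℕ.*-identityˡ _)) k<D))

recip-cancel-< : ∀ {k D} → 1 ℕ.≤ k → 1 ℕ.≤ D → recip D < recip k → k ℕ.< D
recip-cancel-< {suc k} {suc D} _ _ h = subst₂ ℕ._<_ (ℕ.*-identityˡ _) (ℕ.*-identityˡ _)
  (drop-*<*ₙ refl refl (subst₂ _<_ (recip-suc D) (recip-suc k) h))

-- One step of the greedy underapproximation

greedyStep : ℚ → ℚ
greedyStep r = r - recip (nextTerm r)

module GreedyStep (a b : ℕ) .(coprime : Coprime (suc a) (suc b)) where

  n d q s x : ℕ
  n = suc a
  d = suc b
  q = d / n
  s = d % n
  x = suc q

  r : ℚ
  r = mkℚ +[1+ a ] b coprime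

  nextTerm≡x : nextTerm r ≡ x
  nextTerm≡x with r ℚ.≟ 0ℚ
  ... | yes ()
  ... | no _ = cong (λ z → suc ℤ.∣ z ∣) (ℤ.*-identityˡ (+ q))

  recip-nextTerm≡ : recip (nextTerm r) ≡ mkℚ (+ 1) q (1-coprimeTo x)
  recip-nextTerm≡ = trans (cong recip nextTerm≡x) (recip-suc q)

  recip-nextTerm< : recip (nextTerm r) < r
  recip-nextTerm< = subst (_< r) (sym recip-nextTerm≡)
    (*<*ₙ refl refl (subst (ℕ._< n ℕ.* x) (sym (ℕ.*-identityˡ d)) (d<n*[1+d/n] d n)))

  r<1⇒n<d : r < 1ℚ → n ℕ.< d
  r<1⇒n<d r<1 = subst₂ ℕ._<_ (ℕ.*-identityʳ n) (ℕ.*-identityˡ d) (drop-*<*ₙ refl refl r<1)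

  n≢1⇒s≢0 : n ≢ 1 → s ≢ 0
  n≢1⇒s≢0 n≢1 s≡0 = n≢1 (recompute coprime (∣-refl , m%n≡0⇒n∣m d n s≡0))

  -- r′ is the fraction (n x - d) / (d x) reduced by the factor g.
  module Remainder where

    r′ : ℚ
    r′ = greedyStep r

    0<r′ : 0ℚ < r′
    0<r′ = <⇒0<- recip-nextTerm<

    N : ℕ
    N = n ℕ.* x ∸ d

    private
      -1/x : ℚ
      -1/x = ℚ.- mkℚ (+ 1) q (1-coprimeTo x)

      r′≡r+-1/x : r′ ≡ r + -1/x
      r′≡r+-1/x = cong (λ z → r - z) recip-nextTerm≡

      n*x-d≡N : + n ℤ.* + x ℤ.+ -[1+ 0 ] ℤ.* + d ≡ + N
      n*x-d≡N = begin
        + n ℤ.* + x ℤ.+ -[1+ 0 ] ℤ.* + d ≡⟨ cong₂ ℤ._+_ (sym (ℤ.pos-* n x)) (ℤ.-1*i≡-i (+ d)) ⟩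
        + (n ℕ.* x) ℤ.- + d              ≡⟨ ℤ.m-n≡m⊖n (n ℕ.* x) d ⟩
        (n ℕ.* x) ℤ.⊖ d                  ≡⟨ ℤ.⊖-≥ (ℕ.<⇒≤ (d<n*[1+d/n] d n)) ⟩
        + N                              ∎
        where open ≡-Reasoning

    g : ℕ
    g = proj₁ (+-reduced r -1/x)

    ↥r′*g≡N : ↥ₙ r′ ℕ.* g ≡ N
    ↥r′*g≡N = ℤ.+-injective (begin
      + (↥ₙ r′ ℕ.* g)                  ≡⟨ ℤ.pos-* (↥ₙ r′) g ⟩
      + ↥ₙ r′ ℤ.* + g                  ≡⟨ cong (ℤ._* + g) (sym (0<p⇒↥p≡+↥ₙp 0<r′)) ⟩
      ↥ r′ ℤ.* + g                     ≡⟨ cong (λ z → ↥ z ℤ.* + g) r′≡r+-1/x ⟩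
      ↥ (r + -1/x) ℤ.* + g             ≡⟨ proj₁ (proj₂ (+-reduced r -1/x)) ⟩
      + n ℤ.* + x ℤ.+ -[1+ 0 ] ℤ.* + d ≡⟨ n*x-d≡N ⟩
      + N                              ∎)
      where open ≡-Reasoning

    ↧r′*g≡d*x : ↧ₙ r′ ℕ.* g ≡ d ℕ.* x
    ↧r′*g≡d*x = ℤ.+-injective (begin
      + (↧ₙ r′ ℕ.* g)          ≡⟨ ℤ.pos-* (↧ₙ r′) g ⟩
      ℚ.↧ r′ ℤ.* + g           ≡⟨ cong (λ z → ℚ.↧ z ℤ.* + g) r′≡r+-1/x ⟩
      ℚ.↧ (r + -1/x) ℤ.* + g   ≡⟨ proj₂ (proj₂ (+-reduced r -1/x)) ⟩
      + d ℤ.* + x              ≡⟨ sym (ℤ.pos-* d x) ⟩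
      + (d ℕ.* x)              ∎)
      where open ≡-Reasoning

    g≢0 : g ≢ 0
    g≢0 g≡0 with trans (sym ↧r′*g≡d*x) (trans (cong (↧ₙ r′ ℕ.*_) g≡0) (ℕ.*-zeroʳ (↧ₙ r′)))
    ... | ()

    ↥r′≤N : ↥ₙ r′ ℕ.≤ N
    ↥r′≤N = subst (↥ₙ r′ ℕ.≤_) ↥r′*g≡N (ℕ.m≤m*n (↥ₙ r′) g {{ℕ.≢-nonZero g≢0}})

    ↥r′<n : n ≢ 1 → ↥ₙ r′ ℕ.< n
    ↥r′<n n≢1 = ℕ.≤-<-trans ↥r′≤N (subst (ℕ._< n) (sym (n*[1+d/n]∸d≡n∸d%n d n))
      (ℕ.∸-monoʳ-< (ℕ.n≢0⇒n>0 (n≢1⇒s≢0 n≢1)) (ℕ.<⇒≤ (m%n<n d n))))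

    r′<recip-nextTerm : n ℕ.< d → r′ < recip (nextTerm r)
    r′<recip-nextTerm n<d = subst (r′ <_) (sym recip-nextTerm≡)
      (*<*ₙ (0<p⇒↥p≡+↥ₙp 0<r′) refl
        (subst (↥ₙ r′ ℕ.* x ℕ.<_) (sym (ℕ.*-identityˡ (↧ₙ r′))) ↥r′*x<↧r′))
      where
        N<d : N ℕ.< d
        N<d = subst (ℕ._< d) (sym (n*[1+d/n]∸d≡n∸d%n d n)) (ℕ.≤-<-trans (ℕ.m∸n≤m n s) n<d)

        ↥r′*x<↧r′ : ↥ₙ r′ ℕ.* x ℕ.< ↧ₙ r′
        ↥r′*x<↧r′ = ℕ.*-cancelʳ-< g (↥ₙ r′ ℕ.* x) (↧ₙ r′) (begin-strict
          ↥ₙ r′ ℕ.* x ℕ.* g   ≡⟨ ℕ.*-assoc (↥ₙ r′) x g ⟩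
          ↥ₙ r′ ℕ.* (x ℕ.* g) ≡⟨ cong (↥ₙ r′ ℕ.*_) (ℕ.*-comm x g) ⟩
          ↥ₙ r′ ℕ.* (g ℕ.* x) ≡⟨ sym (ℕ.*-assoc (↥ₙ r′) g x) ⟩
          ↥ₙ r′ ℕ.* g ℕ.* x   ≡⟨ cong (ℕ._* x) ↥r′*g≡N ⟩
          N ℕ.* x             <⟨ ℕ.*-monoˡ-< x N<d ⟩
          d ℕ.* x             ≡⟨ sym ↧r′*g≡d*x ⟩
          ↧ₙ r′ ℕ.* g         ∎)
          where open ℕ.≤-Reasoning

  2≤nextTerm : r < 1ℚ → 2 ℕ.≤ nextTerm r
  2≤nextTerm r<1 = subst (2 ℕ.≤_) (sym nextTerm≡x) (s≤s (m≥n⇒m/n>0 (ℕ.<⇒≤ (r<1⇒n<d r<1))))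

  greedyStep<recip-nextTerm : r < 1ℚ → greedyStep r < recip (nextTerm r)
  greedyStep<recip-nextTerm r<1 = Remainder.r′<recip-nextTerm (r<1⇒n<d r<1)

  nextTerm-least : n ≢ 1 → ∀ k → 2 ℕ.≤ k → k ℕ.< nextTerm r → r < recip k
  nextTerm-least n≢1 (suc k) _ k<nextTerm = subst (r <_) (sym (recip-suc k))
    (*<*ₙ refl refl (subst₂ ℕ._<_ (ℕ.*-comm (suc k) n) (sym (ℕ.*-identityˡ d))
      (k≤d/n⇒k*n<d d n (n≢1⇒s≢0 n≢1) (suc k) (ℕ.s≤s⁻¹ (subst (suc k ℕ.<_) nextTerm≡x k<nextTerm)))))

  <nextTerm : ∀ y → r < recip (suc y) → suc y ℕ.< nextTerm r
  <nextTerm y r<recip = subst (suc y ℕ.<_) (sym nextTerm≡x) (s≤s (k*n≤d⇒k≤d/n d n (suc y) (ℕ.<⇒≤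
    (subst₂ ℕ._<_ (ℕ.*-comm n (suc y)) (ℕ.*-identityˡ d)
      (drop-*<*ₙ refl refl (subst (r <_) (recip-suc y) r<recip))))))

module _ {r : ℚ} (0<r : 0ℚ < r) where

  recip-nextTerm< : recip (nextTerm r) < r
  recip-nextTerm< with positiveView 0<r
  ... | fraction a b c = GreedyStep.recip-nextTerm< a b c

  0<greedyStep : 0ℚ < greedyStep r
  0<greedyStep = <⇒0<- recip-nextTerm<

  2≤nextTerm : r < 1ℚ → 2 ℕ.≤ nextTerm r
  2≤nextTerm with positiveView 0<r
  ... | fraction a b c = GreedyStep.2≤nextTerm a b c

  greedyStep<recip-nextTerm : r < 1ℚ → greedyStep r < recip (nextTerm r)
  greedyStep<recip-nextTerm with positiveView 0<r
  ... | fraction a b c = GreedyStep.greedyStep<recip-nextTerm a b c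

  greedyStep< : r < 1ℚ → greedyStep r < r
  greedyStep< r<1 = ℚ.<-trans (greedyStep<recip-nextTerm r<1) recip-nextTerm<

  ↥greedyStep< : ↥ₙ r ≢ 1 → ↥ₙ greedyStep r ℕ.< ↥ₙ r
  ↥greedyStep< with positiveView 0<r
  ... | fraction a b c = GreedyStep.Remainder.↥r′<n a b c

  nextTerm-least : ↥ₙ r ≢ 1 → ∀ k → 2 ℕ.≤ k → k ℕ.< nextTerm r → r < recip k
  nextTerm-least with positiveView 0<r
  ... | fraction a b c = GreedyStep.nextTerm-least a b c

  <nextTerm : ∀ {y} → 1 ℕ.≤ y → r < recip y → y ℕ.< nextTerm r
  <nextTerm {suc y} _ with positiveView 0<r
  ... | fraction a b c = GreedyStep.<nextTerm a b c y

  ↥ₙ≡1⇒unit : ↥ₙ r ≡ 1 → r ≡ recip (↧ₙ r) × nextTerm r ≡ suc (↧ₙ r)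
  ↥ₙ≡1⇒unit with positiveView 0<r
  ... | fraction zero b c = λ _ →
    sym (recip-suc b) , trans (GreedyStep.nextTerm≡x 0 b c) (cong suc (n/1≡n (suc b)))
  ... | fraction (suc _) _ _ = λ ()

remainder-+ : ∀ λ′ M i → remainder λ′ (M ℕ.+ i) ≡ remainder (remainder λ′ M) i
remainder-+ λ′ M zero    = cong (remainder λ′) (ℕ.+-identityʳ M)
remainder-+ λ′ M (suc i) = trans (cong (remainder λ′) (ℕ.+-suc M i)) (cong greedyStep (remainder-+ λ′ M i))

sumRecip-++ : ∀ xs ys → sumRecip (xs ++ ys) ≡ sumRecip xs + sumRecip ys
sumRecip-++ []       ys = sym (ℚ.+-identityˡ _)
sumRecip-++ (x ∷ xs) ys = trans (cong (_+_ (recip x)) (sumRecip-++ xs ys)) (sym (ℚ.+-assoc (recip x) _ _))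

map-upTo-suc : ∀ (f : ℕ → ℕ) i → map f (upTo (suc i)) ≡ map f (upTo i) ++ [ f i ]
map-upTo-suc f i = trans (cong (map f) (sym (List.upTo-∷ʳ i))) (List.map-++ f (upTo i) [ i ])

<⇒∉map-upTo : ∀ (f : ℕ → ℕ) {i y} → (∀ {k} → k ℕ.< i → f k ℕ.< y) → y ∉ map f (upTo i)
<⇒∉map-upTo f below y∈ with ∈-map⁻ f y∈
... | k , k∈ , y≡fk = ℕ.<-irrefl (sym y≡fk) (below (∈-upTo⁻ k∈))

greedyFrom-upTo : ∀ λ′ (x : ℕ → ℕ) i ys → (∀ j → j ℕ.< i → GreedyChoice λ′ (map x (upTo j)) (x j)) →
                  GreedyFrom λ′ (map x (upTo i)) ys → IsGreedyEgyptian λ′ (map x (upTo i) ++ ys)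
greedyFrom-upTo λ′ x zero    ys _      greedy = greedy
greedyFrom-upTo λ′ x (suc i) ys choice greedy = subst (GreedyFrom λ′ []) regroup
  (greedyFrom-upTo λ′ x i (x i ∷ ys) (λ j j<i → choice j (ℕ.m<n⇒m<1+n j<i))
    (choice i ℕ.≤-refl , subst (λ pre → GreedyFrom λ′ pre ys) (map-upTo-suc x i) greedy))
  where
    regroup : map x (upTo i) ++ x i ∷ ys ≡ map x (upTo (suc i)) ++ ys
    regroup = trans (sym (List.++-assoc (map x (upTo i)) [ x i ] ys))
                    (cong (_++ ys) (sym (map-upTo-suc x i)))

increasing⇒< : ∀ (f : ℕ → ℕ) → (∀ i → f i ℕ.< f (suc i)) → ∀ {j i} → j ℕ.< i → f j ℕ.< f i
increasing⇒< f step {j} {suc i} j<1+i with ℕ.m<1+n⇒m<n∨m≡n j<1+i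
... | inj₁ j<i  = ℕ.<-trans (increasing⇒< f step j<i) (step i)
... | inj₂ refl = step i

least-by-descent : ∀ {P : ℕ → Set} → (∀ i → Dec (P i)) → (f : ℕ → ℕ) →
                   (∀ i → ¬ P i → f (suc i) ℕ.< f i) → ∃[ M ] P M × (∀ j → j ℕ.< M → ¬ P j)
least-by-descent {P} P? f descent = search (f 0) 0 ℕ.≤-refl (λ _ ())
  where
    search : ∀ k i → f i ℕ.≤ k → (∀ j → j ℕ.< i → ¬ P j) → ∃[ M ] P M × (∀ j → j ℕ.< M → ¬ P j)
    search k i fi≤k below with P? i
    ... | yes Pi = i , Pi , below
    search zero    i fi≤0   below | no ¬Pi = ⊥-elim (ℕ.n≮0 (ℕ.<-≤-trans (descent i ¬Pi) fi≤0))
    search (suc k) i fi≤1+k below | no ¬Pi =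
      search k (suc i) (ℕ.s≤s⁻¹ (ℕ.<-≤-trans (descent i ¬Pi) fi≤1+k)) below′
      where
        below′ : ∀ j → j ℕ.< suc i → ¬ P j
        below′ j j<1+i with ℕ.m<1+n⇒m<n∨m≡n j<1+i
        ... | inj₁ j<i  = below j j<i
        ... | inj₂ refl = ¬Pi

-- The greedy underapproximation of 0 < λ < 1

module Underapproximation (λ′ : ℚ) (0<λ : 0ℚ < λ′) (λ<1 : λ′ < 1ℚ) where

  r : ℕ → ℚ
  r = remainder λ′

  x : ℕ → ℕ
  x = infGreedy λ′

  S : ℕ → ℚ
  S i = sumRecip (map x (upTo i))

  0<r : ∀ i → 0ℚ < r i
  0<r zero    = 0<λ
  0<r (suc i) = 0<greedyStep (0<r i)

  r<1 : ∀ i → r i < 1ℚ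
  r<1 zero    = λ<1
  r<1 (suc i) = ℚ.<-trans (greedyStep< (0<r i) (r<1 i)) (r<1 i)

  2≤x : ∀ i → 2 ℕ.≤ x i
  2≤x i = 2≤nextTerm (0<r i) (r<1 i)

  1≤x : ∀ i → 1 ℕ.≤ x i
  1≤x i = ℕ.<⇒≤ (2≤x i)

  x-increasing : ∀ {j i} → j ℕ.< i → x j ℕ.< x i
  x-increasing = increasing⇒< x λ i →
    <nextTerm (0<r (suc i)) (1≤x i) (greedyStep<recip-nextTerm (0<r i) (r<1 i))

  S+r≡λ : ∀ i → S i + r i ≡ λ′
  S+r≡λ zero    = ℚ.+-identityˡ λ′
  S+r≡λ (suc i) = begin
    S (suc i) + r (suc i)                               ≡⟨ cong (λ xs → sumRecip xs + r (suc i)) (map-upTo-suc x i) ⟩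
    sumRecip (map x (upTo i) ++ [ x i ]) + r (suc i)    ≡⟨ cong (_+ r (suc i)) (sumRecip-++ (map x (upTo i)) [ x i ]) ⟩
    (S i + (recip (x i) + 0ℚ)) + (r i - recip (x i))    ≡⟨ cancel (S i) (recip (x i)) (r i) ⟩
    S i + r i                                           ≡⟨ S+r≡λ i ⟩
    λ′                                                  ∎
    where
      open ≡-Reasoning
      cancel : ∀ s y t → (s + (y + 0ℚ)) + (t - y) ≡ s + t
      cancel = solve 3 (λ s y t → (s :+ (y :+ con 0ℚ)) :+ (t :- y) := s :+ t) refl
        where open +-*-Solver

  S+recip≤λ : ∀ i y → recip y ≤ r i → S i + recip y ≤ λ′
  S+recip≤λ i _ h = subst (S i + _ ≤_) (S+r≡λ i) (ℚ.+-monoʳ-≤ (S i) h)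

  λ<S+recip : ∀ i k → r i < recip k → λ′ < S i + recip k
  λ<S+recip i _ h = subst (_< S i + _) (S+r≡λ i) (ℚ.+-monoʳ-< (S i) h)

  firstUnit : ∃[ M ] ↥ₙ r M ≡ 1 × (∀ j → j ℕ.< M → ↥ₙ r j ≢ 1)
  firstUnit = least-by-descent (λ i → ↥ₙ r i ℕ.≟ 1) (λ i → ↥ₙ r i) (λ i → ↥greedyStep< (0<r i))

  M : ℕ
  M = proj₁ firstUnit

  ↥r[M]≡1 : ↥ₙ r M ≡ 1
  ↥r[M]≡1 = proj₁ (proj₂ firstUnit)

  ↥r[j]≢1 : ∀ j → j ℕ.< M → ↥ₙ r j ≢ 1
  ↥r[j]≢1 = proj₂ (proj₂ firstUnit)

  D : ℕ
  D = ↧ₙ r M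

  r[M]≡recip-D : r M ≡ recip D
  r[M]≡recip-D = proj₁ (↥ₙ≡1⇒unit (0<r M) ↥r[M]≡1)

  x[M]∸1≡D : x M ∸ 1 ≡ D
  x[M]∸1≡D = cong (_∸ 1) (proj₂ (↥ₙ≡1⇒unit (0<r M) ↥r[M]≡1))

  greedyChoice : ∀ j → j ℕ.< M → GreedyChoice λ′ (map x (upTo j)) (x j)
  greedyChoice j j<M =
    2≤x j ,
    <⇒∉map-upTo x x-increasing ,
    S+recip≤λ j (x j) (ℚ.<⇒≤ (recip-nextTerm< (0<r j))) ,
    λ k 2≤k k<x _ → λ<S+recip j k (nextTerm-least (0<r j) (↥r[j]≢1 j j<M) k 2≤k k<x)

  below-unit : ∀ {K k} → r K ≡ recip (↧ₙ r K) → k ℕ.< K → x k ℕ.< ↧ₙ r K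
  below-unit {suc K} {k} r≡recip k<1+K = ℕ.≤-<-trans x[k]≤x[K]
    (recip-cancel-< (1≤x K) (s≤s z≤n) (subst (_< recip (x K)) r≡recip
      (greedyStep<recip-nextTerm (0<r K) (r<1 K))))
    where
      x[k]≤x[K] : x k ℕ.≤ x K
      x[k]≤x[K] with ℕ.m<1+n⇒m<n∨m≡n k<1+K
      ... | inj₁ k<K  = ℕ.<⇒≤ (x-increasing k<K)
      ... | inj₂ refl = ℕ.≤-refl

  finalChoice : GreedyChoice λ′ (map x (upTo M)) D
  finalChoice =
    recip-cancel-< (s≤s z≤n) (s≤s z≤n) (subst (_< 1ℚ) r[M]≡recip-D (r<1 M)) ,
    <⇒∉map-upTo x (below-unit r[M]≡recip-D) ,
    S+recip≤λ M D (ℚ.≤-reflexive (sym r[M]≡recip-D)) ,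
    λ k 2≤k k<D _ → λ<S+recip M k (subst (_< recip k) (sym r[M]≡recip-D) (recip-antimono-< (ℕ.<⇒≤ 2≤k) k<D))

  finalSum : sumRecip (map x (upTo M) ++ [ D ]) ≡ λ′
  finalSum = begin
    sumRecip (map x (upTo M) ++ [ D ]) ≡⟨ sumRecip-++ (map x (upTo M)) [ D ] ⟩
    S M + (recip D + 0ℚ)              ≡⟨ cong (_+_ (S M)) (trans (ℚ.+-identityʳ (recip D)) (sym r[M]≡recip-D)) ⟩
    S M + r M                         ≡⟨ S+r≡λ M ⟩
    λ′                                ∎
    where open ≡-Reasoning

  greedySplit : ∃[ M ] (IsGreedyEgyptian λ′ (map x (upTo M) ++ [ x M ∸ 1 ])
                        × (∀ i → x (M ℕ.+ i) ≡ infGreedy (recip (x M ∸ 1)) i))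
  greedySplit = M ,
    subst (λ y → IsGreedyEgyptian λ′ (map x (upTo M) ++ [ y ])) (sym x[M]∸1≡D)
      (greedyFrom-upTo λ′ x M [ D ] greedyChoice (finalChoice , finalSum)) ,
    λ i → cong nextTerm (trans (remainder-+ λ′ M i)
                               (cong (λ ρ → remainder ρ i) (trans r[M]≡recip-D (cong recip (sym x[M]∸1≡D)))))

-- The remainders 1 and 1/2 are unit fractions, but their denominators are
-- not admissible (1 < 2, and 2 is taken), so the split only happens at 1/6.
greedyEgyptian-1 : IsGreedyEgyptian 1ℚ (2 ∷ 3 ∷ 6 ∷ [])
greedyEgyptian-1 =
  (2≤2 , (λ ()) , decide≤ , least₂) ,
  (2≤3 , (λ { (here ()) ; (there ()) }) , decide≤ , least₃) ,
  (2≤6 , (λ { (here ()) ; (there (here ())) ; (there (there ())) }) , decide≤ , least₆) ,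
  refl
  where
    decide≤ : ∀ {p q} {yes! : True (p ℚ.≤? q)} → p ≤ q
    decide≤ {yes! = yes!} = toWitness yes!

    decide< : ∀ {p q} {yes! : True (p ℚ.<? q)} → p < q
    decide< {yes! = yes!} = toWitness yes!

    2≤2 : 2 ℕ.≤ 2
    2≤2 = ℕ.≤-refl
    2≤3 : 2 ℕ.≤ 3
    2≤3 = ℕ.n≤1+n 2
    2≤6 : 2 ℕ.≤ 6
    2≤6 = ℕ.m≤m+n 2 4

    least₂ : ∀ k → 2 ℕ.≤ k → k ℕ.< 2 → k ∉ [] → 1ℚ < sumRecip [] + recip k
    least₂ k 2≤k k<2 = ⊥-elim (ℕ.<⇒≱ k<2 2≤k)

    least₃ : ∀ k → 2 ℕ.≤ k → k ℕ.< 3 → k ∉ 2 ∷ [] → 1ℚ < sumRecip (2 ∷ []) + recip k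
    least₃ 1 (s≤s ())
    least₃ 2 _ _ 2∉ = ⊥-elim (2∉ (here refl))
    least₃ (suc (suc (suc _))) _ (s≤s (s≤s (s≤s ())))

    least₆ : ∀ k → 2 ℕ.≤ k → k ℕ.< 6 → k ∉ 2 ∷ 3 ∷ [] → 1ℚ < sumRecip (2 ∷ 3 ∷ []) + recip k
    least₆ 1 (s≤s ())
    least₆ 2 _ _ k∉ = ⊥-elim (k∉ (here refl))
    least₆ 3 _ _ k∉ = ⊥-elim (k∉ (there (here refl)))
    least₆ 4 _ _ _  = decide<
    least₆ 5 _ _ _  = decide<
    least₆ (suc (suc (suc (suc (suc (suc _)))))) _ (s≤s (s≤s (s≤s (s≤s (s≤s (s≤s ()))))))

proposition2p2 : (λ′ : ℚ) → 0ℚ < λ′ → λ′ ≤ 1ℚ →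
    ∃[ M ] (IsGreedyEgyptian λ′ (map (infGreedy λ′) (upTo M) ++ [ infGreedy λ′ M ∸ 1 ])
           × (∀ (i : ℕ) → infGreedy λ′ (M ℕ.+ i) ≡ infGreedy (recip (infGreedy λ′ M ∸ 1)) i))
proposition2p2 λ′ 0<λ λ≤1 with ℚ.<-cmp λ′ 1ℚ
... | tri< λ<1 _ _  = Underapproximation.greedySplit λ′ 0<λ λ<1
... | tri≈ _ refl _ = 2 , greedyEgyptian-1 , λ i → cong nextTerm (remainder-+ 1ℚ 2 i)
... | tri> _ _ λ>1  = ⊥-elim (ℚ.<-irrefl refl (ℚ.<-≤-trans λ>1 λ≤1))
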